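{- Let $\Pi\le\Gamma$ be a subgroup of order $2$ that fixes $S$ setwise, let $\Delta$ be the restriction of $\Pi$ to $R\cup C$, and suppose $\Pi$ restricted to $S$ has $a_1$ orbits of length $1$ and $a_2$ orbits of length $2$; put $\vec a=(a_1,a_2)$. Then $\mathrm{LF}(K_{n,n},\Pi)=\mathrm{LF}(K_{n,n},\Delta,\vec a)$.
   Context: $R,C,S$ are pairwise disjoint $n$-element sets; $\Gamma$ is the group of permutations of $R\cup C\cup S$ preserving $\{R,C,S\}$. $K_{n,n}$ is the complete bipartite graph on $R\cup C$ with bipartition $\{R,C\}$; $\Phi$ is the group of permutations of $R\cup C$ preserving $\{R,C\}$, acting on spanning subgraphs and their one-factorizations via vertices; $\Phi_{\mathcal{F}}$ denotes a stabilizer. For a one-factorization $\mathcal{F}$ of $K_{n,n}$ with $\Delta\le\Phi_{\mathcal{F}}$ and $\delta\in\Delta$, let $\bar\delta$ be the permutation of $R\cup C\cup\mathcal{F}$ (disjoint union) induced by $\delta$ on $R\cup C$ and on $\mathcal{F}$; for a bijection $f:S\to\mathcal{F}$ let $\bar f$ extend $f$ by the identity on $R\cup C$. $(\mathcal{F},f)$ agrees with $\Pi$ if $\{\bar f^{ -1}\bar\delta\bar f:\delta\in\Delta\}=\Pi$; $\mathcal{F}$ (with $\Delta\le\Phi_{\mathcal{F}}$) is compatible with $\Pi$ if some bijection $f$ makes $(\mathcal{F},f)$ agree with $\Pi$. $\mathrm{LF}(K_{n,n},\Pi)$ is the number of distinct one-factorizations of $K_{n,n}$ compatible with $\Pi$.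 For a spanning subgraph $G$ of $K_{n,n}$, a $(\Delta,\vec a)$-factorization of $G$ is a one-factorization $\mathcal{F}$ of $G$ with $\Delta\le\Phi_{\mathcal{F}}$ such that the action of $\Delta$ on $\mathcal{F}$ has exactly $a_i$ orbits of length $i$ for $i=1,2$; $\mathrm{LF}(G,\Delta,\vec a)$ is the number of distinct $(\Delta,\vec a)$-factorizations of $G$. -}

module Defs where

open import Level using (Level; _⊔_)
open import Data.Nat using (ℕ)
open import Data.Fin using (Fin)
open import Data.Bool using (Bool; true)
open import Data.Product using (Σ; ∃; _×_; _,_)
open import Data.Sum using (_⊎_; inj₁; inj₂)
open import Relation.Binary.PropositionalEquality using (_≡_)
open import Relation.Nullary using (¬_)
open import Function using (id)

-- The vertex set R ∪ C ∪ S.  R = {(R,i)}, C = {(C,i)}, S = {inj₂ i}.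

data Side : Set where
  R C : Side

RC : ℕ → Set
RC n = Side × Fin n

Vert : ℕ → Set
Vert n = RC n ⊎ Fin n

data Part : Set where
  pR pC pS : Part

elt : ∀ {n} → Part → Fin n → Vert n
elt pR i = inj₁ (R , i)
elt pC i = inj₁ (C , i)
elt pS i = inj₂ i

MapsPartOnto : ∀ {n} → (Vert n → Vert n) → Part → Part → Set
MapsPartOnto g p q =
  (∀ i → ∃ λ j → g (elt p i) ≡ elt q j) × (∀ j → ∃ λ i → g (elt p i) ≡ elt q j)

PreservesParts : ∀ {n} → (Vert n → Vert n) → Set
PreservesParts g = ∀ p → ∃ λ q → MapsPartOnto g p q

_≗'_ : ∀ {a b} {A : Set a} {B : Set b} → (A → B) → (A → B) → Set (a ⊔ b)
g ≗' h = ∀ x → g x ≡ h x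

-- Edge sets of spanning subgraphs of K_{n,n}.  The edge (i , j) is
-- {(R,i), (C,j)}; an edge set is its characteristic function.

EdgeSet : ℕ → Set
EdgeSet n = Fin n → Fin n → Bool

_≐_ : ∀ {n} → EdgeSet n → EdgeSet n → Set
M ≐ M' = ∀ i j → M i j ≡ M' i j

complete : ∀ {n} → EdgeSet n
complete i j = true

EdgeIs : ∀ {n} → RC n → RC n → Fin n → Fin n → Set
EdgeIs u v i j = (u ≡ (R , i) × v ≡ (C , j)) ⊎ (u ≡ (C , j) × v ≡ (R , i))

IsImage : ∀ {n} → (RC n → RC n) → EdgeSet n → EdgeSet n → Set
IsImage ε M M' = ∀ i j →
  (M' i j ≡ true → ∃ λ i' → ∃ λ j' → M i' j' ≡ true × EdgeIs (ε (R , i')) (ε (C , j')) i j)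
  × ((∃ λ i' → ∃ λ j' → M i' j' ≡ true × EdgeIs (ε (R , i')) (ε (C , j')) i j) → M' i j ≡ true)

∃! : ∀ {a} {A : Set a} → (A → Set) → Set a
∃! P = ∃ λ x → P x × (∀ y → P y → y ≡ x)

IsOneFactor : ∀ {n} → EdgeSet n → EdgeSet n → Set
IsOneFactor G M =
  (∀ i j → M i j ≡ true → G i j ≡ true)
  × (∀ i → ∃! λ j → M i j ≡ true)
  × (∀ j → ∃! λ i → M i j ≡ true)

-- Sets of edge sets (sets of one-factors), taken extensionally.

FSet : ℕ → Set₁
FSet n = EdgeSet n → Set

_∈ᶠ_ : ∀ {n} → EdgeSet n → FSet n → Set
M ∈ᶠ F = ∃ λ M' → F M' × M ≐ M'

_≋_ : ∀ {n} → FSet n → FSet n → Set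
F ≋ F' = ∀ M → (M ∈ᶠ F → M ∈ᶠ F') × (M ∈ᶠ F' → M ∈ᶠ F)

IsOneFactorization : ∀ {n} → EdgeSet n → FSet n → Set
IsOneFactorization G F =
  (∀ M → M ∈ᶠ F → IsOneFactor G M)
  × (∀ i j → G i j ≡ true → ∃ λ M → M ∈ᶠ F × M i j ≡ true)
  × (∀ i j M M' → M ∈ᶠ F → M' ∈ᶠ F → M i j ≡ true → M' i j ≡ true → M ≐ M')

Stabilizes : ∀ {n} → (RC n → RC n) → FSet n → Set
Stabilizes ε F =
  (∀ M → M ∈ᶠ F → ∃ λ M' → M' ∈ᶠ F × IsImage ε M M')
  × (∀ M' → M' ∈ᶠ F → ∃ λ M → M ∈ᶠ F × IsImage ε M M')

DeltaLe : ∀ {n} → (RC n → RC n) → FSet n → Set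
DeltaLe δ F = Stabilizes id F × Stabilizes δ F

record Count {a ℓ p} (A : Set a) (_≈_ : A → A → Set ℓ) (P : A → Set p)
             (k : ℕ) : Set (a ⊔ ℓ ⊔ p) where
  field
    elem     : Fin k → A
    inP      : ∀ i → P (elem i)
    distinct : ∀ i j → elem i ≈ elem j → i ≡ j
    cover    : ∀ x → P x → ∃ λ i → x ≈ elem i

InOrbitS : ∀ {n} → (Vert n → Vert n) → Fin n → Fin n → Set
InOrbitS π t s = t ≡ s ⊎ π (inj₂ s) ≡ inj₂ t

InOrbitΔ : ∀ {n} → (RC n → RC n) → EdgeSet n → EdgeSet n → Set
InOrbitΔ δ M' M = IsImage id M M' ⊎ IsImage δ M M'

OrbitsS₁ : ∀ {n} → (Vert n → Vert n) → ℕ → Set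
OrbitsS₁ π k = Count _ (InOrbitS π) (λ s → π (inj₂ s) ≡ inj₂ s) k

OrbitsS₂ : ∀ {n} → (Vert n → Vert n) → ℕ → Set
OrbitsS₂ π k = Count _ (InOrbitS π) (λ s → ¬ (π (inj₂ s) ≡ inj₂ s)) k

OrbitsF₁ : ∀ {n} → (RC n → RC n) → FSet n → ℕ → Set
OrbitsF₁ δ F k = Count _ (InOrbitΔ δ) (λ M → M ∈ᶠ F × IsImage δ M M) k

OrbitsF₂ : ∀ {n} → (RC n → RC n) → FSet n → ℕ → Set
OrbitsF₂ δ F k = Count _ (InOrbitΔ δ) (λ M → M ∈ᶠ F × ¬ IsImage δ M M) k

IsBijOnto : ∀ {n} → (Fin n → EdgeSet n) → FSet n → Set
IsBijOnto f F =
  (∀ s → f s ∈ᶠ F)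
  × (∀ s t → f s ≐ f t → s ≡ t)
  × (∀ M → M ∈ᶠ F → ∃ λ s → M ≐ f s)

-- g = f̄⁻¹ ε̄ f̄ (written as f̄ ∘ g = ε̄ ∘ f̄, pointwise)
Conj : ∀ {n} → (RC n → RC n) → (Fin n → EdgeSet n) → (Vert n → Vert n) → Set
Conj ε f g =
  (∀ v → g (inj₁ v) ≡ inj₁ (ε v))
  × (∀ s → ∃ λ t → g (inj₂ s) ≡ inj₂ t × IsImage ε (f s) (f t))

-- (F , f) agrees with Π = {id , π}:  { f̄⁻¹ ε̄ f̄ : ε ∈ Δ } = Π
Agrees : ∀ {n} → (Vert n → Vert n) → (RC n → RC n) → (Fin n → EdgeSet n) → Set
Agrees π δ f = ∀ (g : Vert _ → Vert _) →
  ((Conj id f g ⊎ Conj δ f g) → (g ≗' id ⊎ g ≗' π))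
  × ((g ≗' id ⊎ g ≗' π) → (Conj id f g ⊎ Conj δ f g))

Compatible : ∀ {n} → (Vert n → Vert n) → (RC n → RC n) → FSet n → Set
Compatible π δ F =
  IsOneFactorization complete F × DeltaLe δ F
  × ∃ λ f → IsBijOnto f F × Agrees π δ f

IsΔaFactorization : ∀ {n} → (RC n → RC n) → ℕ → ℕ → EdgeSet n → FSet n → Set
IsΔaFactorization δ a₁ a₂ G F =
  IsOneFactorization G F × DeltaLe δ F × OrbitsF₁ δ F a₁ × OrbitsF₂ δ F a₂

LFΠ : ∀ n → (Vert n → Vert n) → (RC n → RC n) → ℕ → Set₁
LFΠ n π δ k = Count (FSet n) _≋_ (Compatible π δ) k

LFΔ : ∀ n → EdgeSet n → (RC n → RC n) → ℕ → ℕ → ℕ → Set₁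
LFΔ n G δ a₁ a₂ k = Count (FSet n) _≋_ (IsΔaFactorization δ a₁ a₂ G) k

module Submission where

-- Both sides count one-factorizations F of K_{n,n} with Δ ≤ Φ_F, up to
-- extensional equality; they differ only in the extra condition on F.  We
-- prove the two conditions equivalent for every F, so the counts agree.
-- Write πS for the involution that π induces on S, and call f : S → F
-- equivariant when δ maps the factor f s onto the factor f (πS s).
--   * For an injective f, (F , f) agrees with Π iff f is equivariant.
--   * An equivariant bijection S → F matches the orbits of length 1 and 2
--     of Π on S with those of Δ on F, so it transfers the orbit counts:
--     a compatible F is a (Δ , a)-factorization.
--   * Conversely, if Δ has a₁ fixed factors and a₂ orbits of length 2 on F,
--     an equivariant bijection is built orbit by orbit: the i-th fixed point
--     of πS goes to the i-th fixed factor, and the i-th 2-orbit {s , πS s}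
--     goes to the i-th 2-orbit {M , δ M}.  So F is compatible with Π.

open import Defs
open import Data.Nat using (ℕ)
open import Data.Sum using (inj₁; inj₂; _⊎_)
open import Data.Sum.Properties using (inj₁-injective; inj₂-injective)
open import Data.Product using (_×_; _,_; proj₁; proj₂; ∃)
open import Data.Fin using (Fin)
import Data.Fin.Properties as FinP
open import Data.Bool using (Bool; true; false)
import Data.Bool.Properties as BoolP
open import Data.Empty using (⊥; ⊥-elim)
open import Relation.Binary.PropositionalEquality
  using (_≡_; refl; sym; trans; cong; subst; subst₂)
open import Relation.Nullary using (¬_; Dec; yes; no)
open import Function using (id)

Count-resp : ∀ {a ℓ p q} {A : Set a} {_≈_ : A → A → Set ℓ}
  {P : A → Set p} {Q : A → Set q} {k : ℕ}
  → (∀ x → P x → Q x) → (∀ x → Q x → P x) → Count A _≈_ P k → Count A _≈_ Q k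
Count-resp P⇒Q Q⇒P c = record
  { elem     = Count.elem c
  ; inP      = λ i → P⇒Q _ (Count.inP c i)
  ; distinct = Count.distinct c
  ; cover    = λ x qx → Count.cover c x (Q⇒P x qx)
  }

bool-ext : ∀ {a b : Bool} → (a ≡ true → b ≡ true) → (b ≡ true → a ≡ true) → a ≡ b
bool-ext {true}  {true}  _ _ = refl
bool-ext {false} {false} _ _ = refl
bool-ext {true}  {false} a⇒b _ with a⇒b refl
... | ()
bool-ext {false} {true}  _ b⇒a with b⇒a refl
... | ()

module EdgeSets {n : ℕ} where

  ≐-refl : {M : EdgeSet n} → M ≐ M
  ≐-refl i j = refl

  ≐-sym : {M M' : EdgeSet n} → M ≐ M' → M' ≐ M
  ≐-sym M≐M' i j = sym (M≐M' i j)

  ≐-trans : {M M' M'' : EdgeSet n} → M ≐ M' → M' ≐ M'' → M ≐ M''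
  ≐-trans M≐M' M'≐M'' i j = trans (M≐M' i j) (M'≐M'' i j)

  ≐-dec : (M M' : EdgeSet n) → Dec (M ≐ M')
  ≐-dec M M' = FinP.all? (λ i → FinP.all? (λ j → M i j BoolP.≟ M' i j))

  image-unique : (ε : RC n → RC n) {M A B : EdgeSet n}
    → IsImage ε M A → IsImage ε M B → A ≐ B
  image-unique ε MA MB i j =
    bool-ext (λ e → proj₂ (MB i j) (proj₁ (MA i j) e))
             (λ e → proj₂ (MA i j) (proj₁ (MB i j) e))

  image-resp : (ε : RC n → RC n) {M M' A A' : EdgeSet n}
    → M ≐ M' → A ≐ A' → IsImage ε M A → IsImage ε M' A'
  image-resp ε M≐M' A≐A' MA i j =
      (λ e → let (i' , j' , M-e , edge) = proj₁ (MA i j) (trans (A≐A' i j) e)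
             in i' , j' , trans (sym (M≐M' _ _)) M-e , edge)
    , (λ { (i' , j' , M'-e , edge) →
           trans (sym (A≐A' i j)) (proj₂ (MA i j) (i' , j' , trans (M≐M' _ _) M'-e , edge)) })

  image-ext : {ε ε' : RC n → RC n} {M A : EdgeSet n}
    → (∀ v → ε v ≡ ε' v) → IsImage ε M A → IsImage ε' M A
  image-ext ε≗ε' MA i j =
      (λ e → let (i' , j' , M-e , edge) = proj₁ (MA i j) e
             in i' , j' , M-e , subst₂ (λ u v → EdgeIs u v i j) (ε≗ε' _) (ε≗ε' _) edge)
    , (λ { (i' , j' , M-e , edge) → proj₂ (MA i j)
           (i' , j' , M-e , subst₂ (λ u v → EdgeIs u v i j) (sym (ε≗ε' _)) (sym (ε≗ε' _)) edge) })

  edge-RC : ∀ {a b i j : Fin n} → EdgeIs (R , a) (C , b) i j → a ≡ i × b ≡ j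
  edge-RC (inj₁ (refl , refl)) = refl , refl
  edge-RC (inj₂ (() , _))

  edge-CR : ∀ {a b i j : Fin n} → EdgeIs (C , b) (R , a) i j → a ≡ i × b ≡ j
  edge-CR (inj₁ (() , _))
  edge-CR (inj₂ (refl , refl)) = refl , refl

  image-id : {M : EdgeSet n} → IsImage id M M
  image-id {M} i j = (λ e → i , j , e , inj₁ (refl , refl)) , back
    where
    back : (∃ λ i' → ∃ λ j' → M i' j' ≡ true × EdgeIs (R , i') (C , j') i j) → M i j ≡ true
    back (i' , j' , M-e , edge) with edge-RC edge
    ... | refl , refl = M-e

  image-id⇒≐ : {M A : EdgeSet n} → IsImage id M A → M ≐ A
  image-id⇒≐ = image-unique id image-id

  ≐⇒image-id : {M A : EdgeSet n} → M ≐ A → IsImage id M A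
  ≐⇒image-id M≐A = image-resp id ≐-refl M≐A image-id

open EdgeSets

module InvolutiveImage {n : ℕ} (δ : RC n → RC n) (δδ : ∀ v → δ (δ v) ≡ v)
  (δ-edge : ∀ i j → ∃ λ p → ∃ λ q → EdgeIs (δ (R , i)) (δ (C , j)) p q) where

  image-sym : {A B : EdgeSet n} → IsImage δ A B → IsImage δ B A
  image-sym {A} {B} AB i j = to , from
    where
    δ⁻ : ∀ {v w} → δ v ≡ w → δ w ≡ v
    δ⁻ {v} e = trans (cong δ (sym e)) (δδ v)

    to : A i j ≡ true → ∃ λ i' → ∃ λ j' → B i' j' ≡ true × EdgeIs (δ (R , i')) (δ (C , j')) i j
    to e with δ-edge i j
    ... | p , q , inj₁ (e₁ , e₂) =
      p , q , proj₂ (AB p q) (i , j , e , inj₁ (e₁ , e₂)) , inj₁ (δ⁻ e₁ , δ⁻ e₂)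
    ... | p , q , inj₂ (e₁ , e₂) =
      p , q , proj₂ (AB p q) (i , j , e , inj₂ (e₁ , e₂)) , inj₂ (δ⁻ e₂ , δ⁻ e₁)

    -- an A-edge mapped by δ onto (i' , j'), where (i' , j') is mapped onto (i , j),
    -- must be (i , j) itself since δ is an involution
    back : ∀ {i' j'} → EdgeIs (δ (R , i')) (δ (C , j')) i j
      → (∃ λ i'' → ∃ λ j'' → A i'' j'' ≡ true × EdgeIs (δ (R , i'')) (δ (C , j'')) i' j')
      → A i j ≡ true
    back edge (_ , _ , A-e , inj₁ (f₁ , f₂))
      with edge-RC (subst₂ (λ u v → EdgeIs u v i j) (δ⁻ f₁) (δ⁻ f₂) edge)
    ... | refl , refl = A-e
    back edge (_ , _ , A-e , inj₂ (f₁ , f₂))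
      with edge-CR (subst₂ (λ u v → EdgeIs u v i j) (δ⁻ f₂) (δ⁻ f₁) edge)
    ... | refl , refl = A-e

    from : (∃ λ i' → ∃ λ j' → B i' j' ≡ true × EdgeIs (δ (R , i')) (δ (C , j')) i j)
      → A i j ≡ true
    from (i' , j' , B-e , edge) = back edge (proj₁ (AB i' j') B-e)

part-side : ∀ {n} (q : Part) {j' : Fin n} {X : Side} {a : Fin n} (b : Fin n)
  → elt {n} q j' ≡ inj₁ (X , a) → elt q b ≡ inj₁ (X , b)
part-side pR b refl = refl
part-side pC b refl = refl
part-side pS b ()

module Setup (n : ℕ) (π : Vert n → Vert n) (π-parts : PreservesParts π)
  (ππ : ∀ x → π (π x) ≡ x) (π-S : MapsPartOnto π pS pS)
  (δ : RC n → RC n) (π≡δ : ∀ v → π (inj₁ v) ≡ inj₁ (δ v)) where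

  π-injective : ∀ {x y} → π x ≡ π y → x ≡ y
  π-injective {x} {y} e = trans (sym (ππ x)) (trans (cong π e) (ππ y))

  δ-involutive : ∀ v → δ (δ v) ≡ v
  δ-involutive v = inj₁-injective
    (trans (sym (π≡δ (δ v))) (trans (cong π (sym (π≡δ v))) (ππ (inj₁ v))))

  -- δ never sends both ends of an edge into the same side, because π maps
  -- R onto one whole part, which then cannot also contain the image of a C-vertex.
  δ-splits-edge : ∀ {X a b i j} → δ (R , i) ≡ (X , a) → δ (C , j) ≡ (X , b) → ⊥
  δ-splits-edge {X} {a} {b} {i} {j} e₁ e₂ with π-parts pR
  ... | q , R↦q , onto-q = R≢C (π-injective
        (trans (proj₂ (onto-q b)) (trans q-side (sym (trans (π≡δ (C , j)) (cong inj₁ e₂))))))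
    where
    q-side : elt q b ≡ inj₁ (X , b)
    q-side = part-side q b (trans (sym (proj₂ (R↦q i))) (trans (π≡δ (R , i)) (cong inj₁ e₁)))
    R≢C : ∀ {i' j' : Fin n} → _≡_ {A = Vert n} (inj₁ (R , i')) (inj₁ (C , j')) → ⊥
    R≢C ()

  δ-edge : ∀ i j → ∃ λ p → ∃ λ q → EdgeIs (δ (R , i)) (δ (C , j)) p q
  δ-edge i j with δ (R , i) in e₁ | δ (C , j) in e₂
  ... | (R , a) | (C , b) = a , b , inj₁ (refl , refl)
  ... | (C , a) | (R , b) = b , a , inj₂ (refl , refl)
  ... | (R , a) | (R , b) = ⊥-elim (δ-splits-edge e₁ e₂)
  ... | (C , a) | (C , b) = ⊥-elim (δ-splits-edge e₁ e₂)

  open InvolutiveImage δ δ-involutive δ-edge public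

  πS : Fin n → Fin n
  πS s = proj₁ (proj₁ π-S s)

  πS-spec : ∀ s → π (inj₂ s) ≡ inj₂ (πS s)
  πS-spec s = proj₂ (proj₁ π-S s)

  πS-involutive : ∀ s → πS (πS s) ≡ s
  πS-involutive s = inj₂-injective
    (trans (sym (πS-spec (πS s))) (trans (cong π (sym (πS-spec s))) (ππ _)))

  orbit⇒πS : ∀ {s t} → π (inj₂ s) ≡ inj₂ t → πS s ≡ t
  orbit⇒πS {s} e = inj₂-injective (trans (sym (πS-spec s)) e)

  πS⇒orbit : ∀ {s t} → πS s ≡ t → π (inj₂ s) ≡ inj₂ t
  πS⇒orbit {s} e = trans (πS-spec s) (cong inj₂ e)

  Equivariant : (Fin n → EdgeSet n) → Set
  Equivariant f = ∀ s → IsImage δ (f s) (f (πS s))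

  -- Agreement with Π says in particular that π is one of the conjugates f̄⁻¹ ε̄ f̄.
  agrees⇒equivariant : (f : Fin n → EdgeSet n) → Agrees π δ f → Equivariant f
  agrees⇒equivariant f agrees = from-conj (proj₂ (agrees π) (inj₂ (λ _ → refl)))
    where
    target : ∀ ε {s t} → π (inj₂ s) ≡ inj₂ t → IsImage ε (f s) (f t) → IsImage ε (f s) (f (πS s))
    target ε {s} e = subst (λ t → IsImage ε (f s) (f t)) (sym (orbit⇒πS e))
    from-conj : Conj id f π ⊎ Conj δ f π → Equivariant f
    from-conj (inj₁ (π≡id , conj)) s with conj s
    ... | t , e , im = image-ext (λ v → inj₁-injective (trans (sym (π≡id v)) (π≡δ v))) (target id e im)
    from-conj (inj₂ (_ , conj)) s with conj s
    ... | t , e , im = target δ e im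

  equivariant⇒agrees : (f : Fin n → EdgeSet n) → (∀ s t → f s ≐ f t → s ≡ t)
    → Equivariant f → Agrees π δ f
  equivariant⇒agrees f f-inj f-eq g = to , from
    where
    to : Conj id f g ⊎ Conj δ f g → g ≗' id ⊎ g ≗' π
    to (inj₁ (g≡id , conj)) = inj₁ g≗id
      where
      g≗id : g ≗' id
      g≗id (inj₁ v) = g≡id v
      g≗id (inj₂ s) with conj s
      ... | t , e , im = trans e (cong inj₂ (sym (f-inj s t (image-id⇒≐ im))))
    to (inj₂ (g≡δ , conj)) = inj₂ g≗π
      where
      g≗π : g ≗' π
      g≗π (inj₁ v) = trans (g≡δ v) (sym (π≡δ v))
      g≗π (inj₂ s) with conj s
      ... | t , e , im =
        trans e (trans (cong inj₂ (f-inj t (πS s) (image-unique δ im (f-eq s)))) (sym (πS-spec s)))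
    from : g ≗' id ⊎ g ≗' π → Conj id f g ⊎ Conj δ f g
    from (inj₁ g≗id) = inj₁ ((λ v → g≗id (inj₁ v)) , λ s → s , g≗id (inj₂ s) , image-id)
    from (inj₂ g≗π) = inj₂ ((λ v → trans (g≗π (inj₁ v)) (π≡δ v))
                           , λ s → πS s , trans (g≗π (inj₂ s)) (πS-spec s) , f-eq s)

  module Transport (F : FSet n) (f : Fin n → EdgeSet n) (f-bij : IsBijOnto f F)
    (f-eq : Equivariant f) where

    f-inj : ∀ s t → f s ≐ f t → s ≡ t
    f-inj = proj₁ (proj₂ f-bij)

    fixed⇒factor-fixed : ∀ s → π (inj₂ s) ≡ inj₂ s → IsImage δ (f s) (f s)
    fixed⇒factor-fixed s fixed = subst (λ t → IsImage δ (f s) (f t)) (orbit⇒πS fixed) (f-eq s)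

    factor-fixed⇒fixed : ∀ M s → M ≐ f s → IsImage δ M M → π (inj₂ s) ≡ inj₂ s
    factor-fixed⇒fixed M s M≐fs MM =
      πS⇒orbit (sym (f-inj _ _ (image-unique δ (image-resp δ M≐fs M≐fs MM) (f-eq s))))

    transport : ∀ {PS : Fin n → Set} {PF : EdgeSet n → Set} {k : ℕ}
      → (∀ s → PS s → PF (f s)) → (∀ M s → M ≐ f s → PF M → PS s)
      → Count (Fin n) (InOrbitS π) PS k
      → Count (EdgeSet n) (InOrbitΔ δ) (λ M → M ∈ᶠ F × PF M) k
    transport {PS} {PF} PS⇒PF PF⇒PS c = record
      { elem = λ i → f (rep i)
      ; inP = λ i → proj₁ f-bij (rep i) , PS⇒PF (rep i) (Count.inP c i)
      ; distinct = distinct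
      ; cover = cover }
      where
      rep = Count.elem c
      distinct : ∀ i j → InOrbitΔ δ (f (rep i)) (f (rep j)) → i ≡ j
      distinct i j (inj₁ im) = Count.distinct c i j (inj₁ (sym (f-inj _ _ (image-id⇒≐ im))))
      distinct i j (inj₂ im) = Count.distinct c i j
        (inj₂ (trans (πS-spec (rep j)) (cong inj₂ (f-inj _ _ (image-unique δ (f-eq (rep j)) im)))))
      orbit : ∀ M s i → M ≐ f s → InOrbitS π s (rep i) → InOrbitΔ δ M (f (rep i))
      orbit M s i M≐fs (inj₁ refl) = inj₁ (≐⇒image-id (≐-sym M≐fs))
      orbit M s i M≐fs (inj₂ e) with orbit⇒πS e
      ... | refl = inj₂ (image-resp δ ≐-refl (≐-sym M≐fs) (f-eq (rep i)))
      cover : ∀ M → M ∈ᶠ F × PF M → ∃ λ i → InOrbitΔ δ M (f (rep i))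
      cover M (M∈F , pf) with proj₂ (proj₂ f-bij) M M∈F
      ... | s , M≐fs with Count.cover c s (PF⇒PS M s M≐fs pf)
      ... | i , o = i , orbit M s i M≐fs o

    orbits₁ : ∀ {a} → OrbitsS₁ π a → OrbitsF₁ δ F a
    orbits₁ = transport fixed⇒factor-fixed factor-fixed⇒fixed

    orbits₂ : ∀ {a} → OrbitsS₂ π a → OrbitsF₂ δ F a
    orbits₂ = transport
      (λ s not-fixed MM → not-fixed (factor-fixed⇒fixed (f s) s ≐-refl MM))
      (λ M s M≐fs not-fixed fixed →
         not-fixed (image-resp δ (≐-sym M≐fs) (≐-sym M≐fs) (fixed⇒factor-fixed s fixed)))

  module Matching {a₁ a₂ : ℕ} (S₁ : OrbitsS₁ π a₁) (S₂ : OrbitsS₂ π a₂) (F : FSet n)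
    (Δ≤Φ : DeltaLe δ F) (F₁ : OrbitsF₁ δ F a₁) (F₂ : OrbitsF₂ δ F a₂) where

    fixS = Count.elem S₁
    pairS = Count.elem S₂
    fixF = Count.elem F₁
    pairF = Count.elem F₂

    δ-stable : ∀ M → M ∈ᶠ F → ∃ λ M' → M' ∈ᶠ F × IsImage δ M M'
    δ-stable = proj₁ (proj₂ Δ≤Φ)

    pairF' : Fin a₂ → EdgeSet n
    pairF' i = proj₁ (δ-stable (pairF i) (proj₁ (Count.inP F₂ i)))

    pairF'∈F : ∀ i → pairF' i ∈ᶠ F
    pairF'∈F i = proj₁ (proj₂ (δ-stable (pairF i) (proj₁ (Count.inP F₂ i))))

    pairF↦pairF' : ∀ i → IsImage δ (pairF i) (pairF' i)
    pairF↦pairF' i = proj₂ (proj₂ (δ-stable (pairF i) (proj₁ (Count.inP F₂ i))))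

    fixS-fixed : ∀ i → πS (fixS i) ≡ fixS i
    fixS-fixed i = orbit⇒πS (Count.inP S₁ i)

    pairS-moved : ∀ i → ¬ πS (pairS i) ≡ pairS i
    pairS-moved i e = Count.inP S₂ i (πS⇒orbit e)

    fixF-fixed : ∀ i → IsImage δ (fixF i) (fixF i)
    fixF-fixed i = proj₂ (Count.inP F₁ i)

    pairF-moved : ∀ i → ¬ IsImage δ (pairF i) (pairF i)
    pairF-moved i = proj₂ (Count.inP F₂ i)

    pairF'-moved : ∀ i → ¬ IsImage δ (pairF' i) (pairF' i)
    pairF'-moved i fixed = pairF-moved i
      (image-resp δ ≐-refl (image-unique δ fixed (image-sym (pairF↦pairF' i))) (pairF↦pairF' i))

    fixS-inj : ∀ {i j} → fixS i ≡ fixS j → i ≡ j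
    fixS-inj {i} {j} e = Count.distinct S₁ i j (inj₁ e)
    pairS-inj : ∀ {i j} → pairS i ≡ pairS j → i ≡ j
    pairS-inj {i} {j} e = Count.distinct S₂ i j (inj₁ e)
    pairS-orbit : ∀ {i j} → πS (pairS j) ≡ pairS i → i ≡ j
    pairS-orbit {i} {j} e = Count.distinct S₂ i j (inj₂ (πS⇒orbit e))
    fixF-inj : ∀ {i j} → fixF i ≐ fixF j → i ≡ j
    fixF-inj {i} {j} e = Count.distinct F₁ i j (inj₁ (≐⇒image-id (≐-sym e)))
    pairF-inj : ∀ {i j} → pairF i ≐ pairF j → i ≡ j
    pairF-inj {i} {j} e = Count.distinct F₂ i j (inj₁ (≐⇒image-id (≐-sym e)))
    pairF-orbit : ∀ {i j} → IsImage δ (pairF j) (pairF i) → i ≡ j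
    pairF-orbit {i} {j} im = Count.distinct F₂ i j (inj₂ im)

    data Position (s : Fin n) : Set where
      fixed  : (i : Fin a₁) → s ≡ fixS i → Position s
      first  : (i : Fin a₂) → s ≡ pairS i → Position s
      second : (i : Fin a₂) → πS (pairS i) ≡ s → Position s

    position : ∀ s → Position s
    position s with πS s FinP.≟ s
    ... | yes πs≡s with Count.cover S₁ s (πS⇒orbit πs≡s)
    ...   | i , inj₁ s≡ = fixed i s≡
    ...   | i , inj₂ e = fixed i (trans (sym (orbit⇒πS e)) (fixS-fixed i))
    position s | no πs≢s with Count.cover S₂ s (λ fx → πs≢s (orbit⇒πS fx))
    ...   | i , inj₁ s≡ = first i s≡
    ...   | i , inj₂ e = second i (orbit⇒πS e)

    factorAt : ∀ {s} → Position s → EdgeSet n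
    factorAt (fixed i _) = fixF i
    factorAt (first i _) = pairF i
    factorAt (second i _) = pairF' i

    f : Fin n → EdgeSet n
    f s = factorAt (position s)

    fixed-point : ∀ {s i} → s ≡ fixS i → πS s ≡ s
    fixed-point {i = i} refl = fixS-fixed i

    first-moved : ∀ {s i} → s ≡ pairS i → ¬ πS s ≡ s
    first-moved {i = i} refl = pairS-moved i

    second-moved : ∀ {s i} → πS (pairS i) ≡ s → ¬ πS s ≡ s
    second-moved {i = i} refl e = pairS-moved i (trans (sym e) (πS-involutive (pairS i)))

    factorAt-unique : ∀ {s} (p p' : Position s) → factorAt p ≐ factorAt p'
    factorAt-unique (fixed i e) (fixed j e') with fixS-inj (trans (sym e) e')
    ... | refl = ≐-refl
    factorAt-unique (fixed i e) (first j e') = ⊥-elim (first-moved e' (fixed-point e))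
    factorAt-unique (fixed i e) (second j e') = ⊥-elim (second-moved e' (fixed-point e))
    factorAt-unique (first i e) (fixed j e') = ⊥-elim (first-moved e (fixed-point e'))
    factorAt-unique (second i e) (fixed j e') = ⊥-elim (second-moved e (fixed-point e'))
    factorAt-unique (first i e) (first j e') with pairS-inj (trans (sym e) e')
    ... | refl = ≐-refl
    factorAt-unique (first i e) (second j e') with pairS-orbit (trans e' e)
    ... | refl = ⊥-elim (pairS-moved i (trans e' e))
    factorAt-unique (second i e) (first j e') with pairS-orbit (trans e e')
    ... | refl = ⊥-elim (pairS-moved i (trans e e'))
    factorAt-unique (second i e) (second j e') with pairS-inj
      (trans (sym (πS-involutive (pairS i))) (trans (cong πS (trans e (sym e'))) (πS-involutive (pairS j))))
    ... | refl = ≐-refl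

    f-at : ∀ {s} (p : Position s) → f s ≐ factorAt p
    f-at {s} p = factorAt-unique (position s) p

    factorAt∈F : ∀ {s} (p : Position s) → factorAt p ∈ᶠ F
    factorAt∈F (fixed i _) = proj₁ (Count.inP F₁ i)
    factorAt∈F (first i _) = proj₁ (Count.inP F₂ i)
    factorAt∈F (second i _) = pairF'∈F i

    -- Each position of s determines the position of πS s, whose factor is the δ-image.
    equivariantAt : ∀ {s} (p : Position s) → IsImage δ (factorAt p) (f (πS s))
    equivariantAt (fixed i e) =
      image-resp δ ≐-refl (≐-sym (f-at (fixed i (trans (fixed-point e) e)))) (fixF-fixed i)
    equivariantAt (first i e) =
      image-resp δ ≐-refl (≐-sym (f-at (second i (cong πS (sym e))))) (pairF↦pairF' i)
    equivariantAt (second i e) =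
      image-resp δ ≐-refl (≐-sym (f-at (first i (trans (cong πS (sym e)) (πS-involutive _)))))
        (image-sym (pairF↦pairF' i))

    f-equivariant : Equivariant f
    f-equivariant s = equivariantAt (position s)

    -- Factors at distinct positions are distinct: fixed and moved factors
    -- differ, and distinct 2-orbit indices give distinct δ-orbits.
    factorAt-inj : ∀ {s t} (p : Position s) (p' : Position t) → factorAt p ≐ factorAt p' → s ≡ t
    factorAt-inj (fixed i e) (fixed j e') eq with fixF-inj eq
    ... | refl = trans e (sym e')
    factorAt-inj (fixed i _) (first j _) eq = ⊥-elim (pairF-moved j (image-resp δ eq eq (fixF-fixed i)))
    factorAt-inj (fixed i _) (second j _) eq = ⊥-elim (pairF'-moved j (image-resp δ eq eq (fixF-fixed i)))
    factorAt-inj (first i _) (fixed j _) eq =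
      ⊥-elim (pairF-moved i (image-resp δ (≐-sym eq) (≐-sym eq) (fixF-fixed j)))
    factorAt-inj (second i _) (fixed j _) eq =
      ⊥-elim (pairF'-moved i (image-resp δ (≐-sym eq) (≐-sym eq) (fixF-fixed j)))
    factorAt-inj (first i e) (first j e') eq with pairF-inj eq
    ... | refl = trans e (sym e')
    factorAt-inj (first i _) (second j _) eq
      with pairF-orbit (image-resp δ ≐-refl (≐-sym eq) (pairF↦pairF' j))
    ... | refl = ⊥-elim (pairF-moved i (image-resp δ ≐-refl (≐-sym eq) (pairF↦pairF' i)))
    factorAt-inj (second i _) (first j _) eq
      with pairF-orbit (image-resp δ ≐-refl eq (pairF↦pairF' i))
    ... | refl = ⊥-elim (pairF-moved i (image-resp δ ≐-refl eq (pairF↦pairF' i)))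
    factorAt-inj (second i e) (second j e') eq with pairF-inj
      (image-unique δ (image-sym (pairF↦pairF' i))
                      (image-resp δ (≐-sym eq) ≐-refl (image-sym (pairF↦pairF' j))))
    ... | refl = trans (sym e) e'

    f-inj : ∀ s t → f s ≐ f t → s ≡ t
    f-inj s t = factorAt-inj (position s) (position t)

    -- Every factor lies in the orbit of a representative, hence is some f s.
    f-onto : ∀ M → M ∈ᶠ F → ∃ λ s → M ≐ f s
    f-onto M M∈F with δ-stable M M∈F
    ... | M' , _ , MM' with ≐-dec M M'
    ... | yes M≐M' with Count.cover F₁ M (M∈F , image-resp δ ≐-refl (≐-sym M≐M') MM')
    ...   | i , inj₁ im = fixS i , ≐-trans (≐-sym (image-id⇒≐ im)) (≐-sym (f-at (fixed i refl)))
    ...   | i , inj₂ im = fixS i ,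
            ≐-trans (≐-sym (image-unique δ (fixF-fixed i) im)) (≐-sym (f-at (fixed i refl)))
    f-onto M M∈F | M' , _ , MM' | no M≢M'
      with Count.cover F₂ M (M∈F , λ MM → M≢M' (image-unique δ MM MM'))
    ...   | i , inj₁ im = pairS i , ≐-trans (≐-sym (image-id⇒≐ im)) (≐-sym (f-at (first i refl)))
    ...   | i , inj₂ im = πS (pairS i) ,
            ≐-trans (≐-sym (image-unique δ (pairF↦pairF' i) im)) (≐-sym (f-at (second i refl)))

    f-bij : IsBijOnto f F
    f-bij = (λ s → factorAt∈F (position s)) , f-inj , f-onto

  compatible⇒factorization : ∀ {a₁ a₂} → OrbitsS₁ π a₁ → OrbitsS₂ π a₂
    → ∀ F → Compatible π δ F → IsΔaFactorization δ a₁ a₂ complete F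
  compatible⇒factorization S₁ S₂ F (oneFact , Δ≤Φ , f , f-bij , agrees) =
    oneFact , Δ≤Φ , T.orbits₁ S₁ , T.orbits₂ S₂
    where module T = Transport F f f-bij (agrees⇒equivariant f agrees)

  factorization⇒compatible : ∀ {a₁ a₂} → OrbitsS₁ π a₁ → OrbitsS₂ π a₂
    → ∀ F → IsΔaFactorization δ a₁ a₂ complete F → Compatible π δ F
  factorization⇒compatible S₁ S₂ F (oneFact , Δ≤Φ , F₁ , F₂) =
    oneFact , Δ≤Φ , M.f , M.f-bij , equivariant⇒agrees M.f M.f-inj M.f-equivariant
    where module M = Matching S₁ S₂ F Δ≤Φ F₁ F₂

-- For every F the two defining conditions are equivalent, so any count of
-- one side is a count of the other.
lemma4p6 : (n : ℕ) (π : Vert n → Vert n)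
    → PreservesParts π
    → (∀ x → π (π x) ≡ x)
    → ¬ (π ≗' id)
    → MapsPartOnto π pS pS
    → (δ : RC n → RC n) → (∀ v → π (inj₁ v) ≡ inj₁ (δ v))
    → (a₁ a₂ : ℕ) → OrbitsS₁ π a₁ → OrbitsS₂ π a₂
    → ∀ k → (LFΠ n π δ k → LFΔ n complete δ a₁ a₂ k)
          × (LFΔ n complete δ a₁ a₂ k → LFΠ n π δ k)
lemma4p6 n π π-parts ππ _ π-S δ π≡δ a₁ a₂ S₁ S₂ k =
  Count-resp to from , Count-resp from to
  where
  open Setup n π π-parts ππ π-S δ π≡δ
  to : ∀ F → Compatible π δ F → IsΔaFactorization δ a₁ a₂ complete F
  to = compatible⇒factorization S₁ S₂
  from : ∀ F → IsΔaFactorization δ a₁ a₂ complete F → Compatible π δ F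
  from = factorization⇒compatible S₁ S₂
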